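{- There is an absolute constant $C_0$ such that the following holds. Let $\varepsilon \in (0,1)$, let $S_1,\dots,S_s \subseteq [n]$, let $n' \ge C_0 s\varepsilon^{ -3}$ with $n' = \Theta(s\varepsilon^{ -3})$, and let $\phi:[n]\to[n']$ be a uniformly random map. Then with high probability over $\phi$, for all subsets $I \subseteq [s]$, \[ \Big|\bigcup_{i\in I}\phi(S_i)\Big| \ge \min\Big\{\Big|\bigcup_{i\in I}S_i\Big| - \varepsilon s,\ s\Big\}. \]
   Context: $[m] = \{1,\dots,m\}$; $\phi(S) = \{\phi(x) : x \in S\}$.
   Formalization: The parameter ε ranges over the rationals in (0,1). -}

module Defs where

open import Data.Nat using (ℕ; zero; suc; _^_)
open import Data.Bool using (Bool; true; false; not; if_then_else_)
open import Data.Fin using (Fin; zero; suc)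
open import Data.Fin.Subset using (Subset; ⋃; ⁅_⁆; ∣_∣)
open import Data.Vec using (Vec; []; _∷_; lookup)
open import Data.List using (List; []; _∷_; map; concatMap; filterᵇ; length; allFin)
open import Data.Bool.ListAction using (and)
open import Data.Rational using (ℚ; _≤?_; _⊓_; _-_; _*_)
open import Data.Rational using () renaming (_/_ to _/q_)
open import Relation.Nullary.Decidable using (⌊_⌋)
open import Function using (_∘_)

ℕ→ℚ : ℕ → ℚ
ℕ→ℚ k = Data.Integer.+ k /q 1
  where import Data.Integer

elements : ∀ {n} → Subset n → List (Fin n)
elements {n} S = filterᵇ (lookup S) (allFin n)

bigUnion : ∀ {s n} → Subset s → (Fin s → Subset n) → Subset n
bigUnion I S = ⋃ (map S (elements I))

image : ∀ {n n'} → (Fin n → Fin n') → Subset n → Subset n'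
image φ S = ⋃ (map (⁅_⁆ ∘ φ) (elements S))

allSubsets : (s : ℕ) → List (Subset s)
allSubsets zero = [] ∷ []
allSubsets (suc s) = concatMap (λ T → (false ∷ T) ∷ (true ∷ T) ∷ []) (allSubsets s)

allMaps : (n n' : ℕ) → List (Fin n → Fin n')
allMaps zero n' = (λ ()) ∷ []
allMaps (suc n) n' =
  concatMap (λ f → map (λ y → λ { zero → y ; (suc x) → f x }) (allFin n')) (allMaps n n')

goodFor : ∀ {s n n'} → ℚ → (Fin s → Subset n) → (Fin n → Fin n') → Subset s → Bool
goodFor {s} ε S φ I =
  ⌊ ((ℕ→ℚ ∣ bigUnion I S ∣ - ε * ℕ→ℚ s) ⊓ ℕ→ℚ s) ≤? ℕ→ℚ ∣ bigUnion I (image φ ∘ S) ∣ ⌋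

good : ∀ {s n n'} → ℚ → (Fin s → Subset n) → (Fin n → Fin n') → Bool
good {s} ε S φ = and (map (goodFor ε S φ) (allSubsets s))

-- number of bad maps φ : [n] → [n']; failure probability = badCount / n'^n
badCount : ∀ {s} (n n' : ℕ) → ℚ → (Fin s → Subset n) → ℕ
badCount n n' ε S = length (filterᵇ (not ∘ good ε S) (allMaps n n'))

-- Call x ∈ A a collision of φ if φ x = φ y for some later y ∈ A; then ∣A∣ ≤ ∣φ(A)∣ + #collisions.
-- Let k = ⌊ε s⌋. If the inequality fails at I, then ⋃_{i∈I} S_i has more than k collisions; k of
-- them are already collisions of the union of at most 2k of the S_i, and, as ∣⋃_{i∈I} φ(S_i)∣ < s,
-- also of the first s + k points A of that union. So φ sends every point of some k-subset X ⊆ A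
-- into the image of the later points of A, which for fixed (A, X) has probability ≤ ((s + k)/n')^k.
-- By the estimate #{X ⊆ [N] : ∣X∣ ≤ m} ≤ r^m (1 + 1/r)^N with r ≈ 2/ε there are at most
-- (32 r³)^k pairs (A, X), so the failure probability is at most (32 r³ (s + k)/n')^k ≤ 2^-k
-- once n' ≥ 8192 s/ε³, and 2^-k → 0 as s → ∞.
module Submission where

open import Defs

module Counting where
  open import Data.Nat as ℕ using (ℕ; zero; suc; _+_; _*_; _^_; _⊓_; _≡ᵇ_; _/_; _%_; _≤_; _<_; z≤n; s≤s; NonZero)
  open import Data.Nat.Properties as ℕ using (≤-refl; ≤-trans; ≤-reflexive; module ≤-Reasoning)
  open import Data.Bool using (Bool; true; false; _∧_; _∨_; T)
  open import Data.Bool.Properties using (T-∧; T-≡)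
  open import Data.Fin as F using (Fin; zero; suc)
  open import Data.Fin.Subset using (Subset; ⋃; ⁅_⁆; ∣_∣; _∈_; _∉_; _⊆_; _∪_; ⊥; ⊤)
  open import Data.Fin.Subset.Properties
    using (x∈p∪q⁻; x∈p∪q⁺; drop-there; drop-∷-⊆; ∈⊤; ∉⊥; x∈⁅x⁆; x∈⁅y⁆⇒x≡y)
  open import Data.Fin.Subset.Properties
    using (∣⊤∣≡n; ∣⊥∣≡0; ∣⁅x⁆∣≡1; ∣p∣≤∣x∷p∣; p⊆q⇒∣p∣≤∣q∣; p⊂q⇒∣p∣<∣q∣)
  open import Data.Vec using (_∷_; []; lookup; here; there)
  open import Data.Vec.Properties using ([]=⇒lookup; lookup⇒[]=)
  open import Data.List using (List; []; _∷_; [_]; map; concatMap; filterᵇ; length; allFin; tabulate; _++_)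
  open import Data.List.Properties
    using (length-++; length-filter; filter-++; length-map; map-tabulate; length-tabulate)
  open import Data.List.Membership.Propositional using (lose; find) renaming (_∈_ to _∈ₗ_)
  open import Data.List.Membership.Propositional.Properties
    using (∈-concatMap⁺; ∈-concatMap⁻; ∈-++⁺ˡ; ∈-++⁺ʳ; ∈-filter⁺; ∈-filter⁻; ∈-allFin; ∈-map⁺; ∈-map⁻)
  open import Data.List.Relation.Unary.Any using (Any; here; there)
  open import Data.List.Relation.Unary.All as All using (All; []; _∷_)
  open import Data.List.Relation.Unary.Any.Properties using (map⁺; map⁻; any⁺)
  open import Data.Bool.ListAction using (any)
  open import Data.Nat.ListAction using (sum)
  open import Data.Product using (∃-syntax; _×_; _,_; proj₁; proj₂)
  open import Data.Sum using (inj₁; inj₂)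
  open import Data.Empty using (⊥-elim)
  open import Function using (_∘_; id; Equivalence)
  open import Data.Nat.Tactic.RingSolver using (solve-∀)
  open import Algebra.Properties.CommutativeSemigroup ℕ.*-commutativeSemigroup
    using (interchange; x∙yz≈y∙xz; x∙yz≈y∙zx; xy∙z≈y∙xz)
  open import Data.Nat.DivMod using (m≡m%n+[m/n]*n; m%n<n; m/n*n≤m; m*n/n≡m; /-monoˡ-≤)
  open import Relation.Nullary using (contradiction)
  open import Relation.Nullary.Decidable using (T?)
  open import Relation.Binary.PropositionalEquality using (_≡_; refl; sym; trans; cong; cong₂; subst)

  open Equivalence using (to; from)

  private
    variable
      n n' s : ℕ

  count : ∀ {a} {A : Set a} → (A → Bool) → List A → ℕ
  count p = length ∘ filterᵇ p

  module _ {a} {A : Set a} where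

    count-++ : ∀ (p : A → Bool) xs ys → count p (xs ++ ys) ≡ count p xs + count p ys
    count-++ p xs ys = trans (cong length (filter-++ (T? ∘ p) xs ys)) (length-++ (filterᵇ p xs))

    count-mono : ∀ {p q : A → Bool} → (∀ {x} → T (p x) → T (q x)) → ∀ xs → count p xs ≤ count q xs
    count-mono p⇒q [] = z≤n
    count-mono {p} {q} p⇒q (x ∷ xs) with p x | q x | p⇒q {x}
    ... | true  | true  | _   = s≤s (count-mono p⇒q xs)
    ... | true  | false | p⇒q = ⊥-elim (p⇒q _)
    ... | false | true  | _   = ℕ.m≤n⇒m≤1+n (count-mono p⇒q xs)
    ... | false | false | _   = count-mono p⇒q xs

    count-∨ : ∀ (p q : A → Bool) xs → count (λ x → p x ∨ q x) xs ≤ count p xs + count q xs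
    count-∨ p q [] = z≤n
    count-∨ p q (x ∷ xs) with p x | q x
    ... | true  | true  = s≤s (≤-trans (count-∨ p q xs) (ℕ.+-monoʳ-≤ (count p xs) (ℕ.n≤1+n (count q xs))))
    ... | true  | false = s≤s (count-∨ p q xs)
    ... | false | true  = ≤-trans (s≤s (count-∨ p q xs)) (≤-reflexive (sym (ℕ.+-suc (count p xs) (count q xs))))
    ... | false | false = count-∨ p q xs

    count-false : ∀ xs → count (λ (_ : A) → false) xs ≡ 0
    count-false []       = refl
    count-false (_ ∷ xs) = count-false xs

    count-true : ∀ xs → count (λ (_ : A) → true) xs ≡ length xs
    count-true []       = refl
    count-true (_ ∷ xs) = cong suc (count-true xs)

  count-map : ∀ {a b} {A : Set a} {B : Set b} (p : B → Bool) (f : A → B) xs → count p (map f xs) ≡ count (p ∘ f) xs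
  count-map p f []       = refl
  count-map p f (x ∷ xs) with p (f x)
  ... | true  = cong suc (count-map p f xs)
  ... | false = count-map p f xs

  module _ {a b} {A : Set a} {B : Set b} where

    count-any : ∀ (Q : B → A → Bool) ws xs → count (λ x → any (λ w → Q w x) ws) xs ≤ sum (map (λ w → count (Q w) xs) ws)
    count-any Q []       xs = ≤-reflexive (count-false xs)
    count-any Q (w ∷ ws) xs = ≤-trans (count-∨ (Q w) _ xs) (ℕ.+-monoʳ-≤ (count (Q w) xs) (count-any Q ws xs))

    union-bound : ∀ (bad : A → Bool) (Q : B → A → Bool) ws → (∀ {x} → T (bad x) → ∃[ w ] w ∈ₗ ws × T (Q w x)) →
      ∀ xs → count bad xs ≤ sum (map (λ w → count (Q w) xs) ws)
    union-bound bad Q ws bad⇒Q xs = ≤-trans (count-mono witness xs) (count-any Q ws xs)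
      where
      witness : ∀ {x} → T (bad x) → T (any (λ w → Q w x) ws)
      witness bad-x with bad⇒Q bad-x
      ... | w , w∈ws , Q-w-x = any⁺ _ (lose w∈ws Q-w-x)

    length-concatMap : ∀ (f : A → List B) xs → length (concatMap f xs) ≡ sum (map (length ∘ f) xs)
    length-concatMap f []       = refl
    length-concatMap f (x ∷ xs) = trans (length-++ (f x)) (cong (length (f x) +_) (length-concatMap f xs))

  *-sum-≤ : ∀ {a} {A : Set a} c (g : A → ℕ) M xs → (∀ {x} → x ∈ₗ xs → c * g x ≤ M) → c * sum (map g xs) ≤ length xs * M
  *-sum-≤ c g M []       _      = ≤-reflexive (ℕ.*-zeroʳ c)
  *-sum-≤ c g M (x ∷ xs) cg≤M = ≤-trans (≤-reflexive (ℕ.*-distribˡ-+ c (g x) _))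
    (ℕ.+-mono-≤ (cg≤M (here refl)) (*-sum-≤ c g M xs (cg≤M ∘ there)))

  module _ {a b ℓ} {A : Set a} {B : Set b} {C : Set ℓ} where

    count-concatMap-map : ∀ (E : A → B → C) ys (q : C → Bool) (p : A → Bool) (c : A → B → Bool) M →
      (∀ f y → T (q (E f y)) → T (c f y) × T (p f)) → (∀ f → count (c f) ys ≤ M) →
      ∀ fs → count q (concatMap (λ f → map (E f) ys) fs) ≤ M * count p fs
    count-concatMap-map E ys q p c M q⇒c×p c≤M [] = z≤n
    count-concatMap-map E ys q p c M q⇒c×p c≤M (f ∷ fs) = begin
      count q (map (E f) ys ++ concatMap (λ f → map (E f) ys) fs)
        ≡⟨ count-++ q (map (E f) ys) _ ⟩
      count q (map (E f) ys) + count q (concatMap (λ f → map (E f) ys) fs)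
        ≤⟨ ℕ.+-mono-≤ (≤-trans (≤-reflexive (count-map q (E f) ys)) block)
                      (count-concatMap-map E ys q p c M q⇒c×p c≤M fs) ⟩
      M * count p [ f ] + M * count p fs
        ≡⟨ ℕ.*-distribˡ-+ M (count p [ f ]) (count p fs) ⟨
      M * (count p [ f ] + count p fs)
        ≡⟨ cong (M *_) (count-++ p [ f ] fs) ⟨
      M * count p (f ∷ fs) ∎
      where
      open ≤-Reasoning
      block : count (q ∘ E f) ys ≤ M * count p [ f ]
      block with p f | q⇒c×p f
      ... | true  | q⇒c×⊤ = ≤-trans (count-mono (λ {y} → proj₁ ∘ q⇒c×⊤ y) ys)
                                     (≤-trans (c≤M f) (≤-reflexive (sym (ℕ.*-identityʳ M))))
      ... | false | q⇒c×⊥ = ≤-trans (count-mono (λ {y} → proj₂ ∘ q⇒c×⊥ y) ys)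
                                     (≤-reflexive (trans (count-false ys) (sym (ℕ.*-zeroʳ M))))

  T-lookup⇒∈ : ∀ {x : Fin n} (p : Subset n) → T (lookup p x) → x ∈ p
  T-lookup⇒∈ {x = x} p t = lookup⇒[]= x p (to T-≡ t)

  ∈⇒T-lookup : ∀ {x : Fin n} {p : Subset n} → x ∈ p → T (lookup p x)
  ∈⇒T-lookup x∈p = from T-≡ ([]=⇒lookup x∈p)

  count-tabulate-suc : ∀ (p : Fin (suc n) → Bool) → count p (tabulate suc) ≡ count (p ∘ suc) (allFin n)
  count-tabulate-suc {n} p = trans (cong (count p) (sym (map-tabulate id suc))) (count-map p suc (allFin n))

  length-elements : ∀ (p : Subset n) → length (elements p) ≡ ∣ p ∣
  length-elements []          = refl
  length-elements (true ∷ p)  = cong suc (trans (count-tabulate-suc (lookup (true ∷ p))) (length-elements p))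
  length-elements (false ∷ p) = trans (count-tabulate-suc (lookup (false ∷ p))) (length-elements p)

  ∈-elements⁺ : ∀ {x : Fin n} {p : Subset n} → x ∈ p → x ∈ₗ elements p
  ∈-elements⁺ {x = x} {p} x∈p = ∈-filter⁺ (T? ∘ lookup p) (∈-allFin x) (∈⇒T-lookup x∈p)

  ∈-elements⁻ : ∀ {x : Fin n} (p : Subset n) → x ∈ₗ elements p → x ∈ p
  ∈-elements⁻ {n} p = T-lookup⇒∈ p ∘ proj₂ ∘ ∈-filter⁻ (T? ∘ lookup p) {xs = allFin n}

  ∈-⋃⁺ : ∀ {x : Fin n} {ps : List (Subset n)} → Any (x ∈_) ps → x ∈ ⋃ ps
  ∈-⋃⁺ (here x∈p)   = x∈p∪q⁺ (inj₁ x∈p)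
  ∈-⋃⁺ (there x∈ps) = x∈p∪q⁺ (inj₂ (∈-⋃⁺ x∈ps))

  ∈-⋃⁻ : ∀ {x : Fin n} (ps : List (Subset n)) → x ∈ ⋃ ps → Any (x ∈_) ps
  ∈-⋃⁻ []       x∈⊥ = ⊥-elim (∉⊥ x∈⊥)
  ∈-⋃⁻ (p ∷ ps) x∈⋃ with x∈p∪q⁻ p (⋃ ps) x∈⋃
  ... | inj₁ x∈p = here x∈p
  ... | inj₂ x∈q = there (∈-⋃⁻ ps x∈q)

  ∈-bigUnion⁺ : ∀ {x : Fin n} {I : Subset s} (S : Fin s → Subset n) {i} → i ∈ I → x ∈ S i → x ∈ bigUnion I S
  ∈-bigUnion⁺ S i∈I x∈Si = ∈-⋃⁺ (map⁺ (lose (∈-elements⁺ i∈I) x∈Si))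

  ∈-bigUnion⁻ : ∀ {x : Fin n} (I : Subset s) (S : Fin s → Subset n) → x ∈ bigUnion I S → ∃[ i ] i ∈ I × x ∈ S i
  ∈-bigUnion⁻ I S x∈U with find (map⁻ (∈-⋃⁻ (map S (elements I)) x∈U))
  ... | i , i∈I , x∈Si = i , ∈-elements⁻ I i∈I , x∈Si

  ∈-image⁺ : ∀ (φ : Fin n → Fin n') {p x} → x ∈ p → φ x ∈ image φ p
  ∈-image⁺ φ x∈p = ∈-⋃⁺ (map⁺ (lose (∈-elements⁺ x∈p) (x∈⁅x⁆ (φ _))))

  ∈-image⁻ : ∀ (φ : Fin n → Fin n') p {y} → y ∈ image φ p → ∃[ x ] x ∈ p × φ x ≡ y
  ∈-image⁻ φ p y∈φp with find (map⁻ (∈-⋃⁻ (map (⁅_⁆ ∘ φ) (elements p)) y∈φp))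
  ... | x , x∈p , y∈⁅φx⁆ = x , ∈-elements⁻ p x∈p , sym (x∈⁅y⁆⇒x≡y _ y∈⁅φx⁆)

  bigUnion-mono : ∀ {J I : Subset s} (S : Fin s → Subset n) → J ⊆ I → bigUnion J S ⊆ bigUnion I S
  bigUnion-mono {J = J} S J⊆I x∈U with ∈-bigUnion⁻ J S x∈U
  ... | i , i∈J , x∈Si = ∈-bigUnion⁺ S (J⊆I i∈J) x∈Si

  image-mono : ∀ (φ : Fin n → Fin n') {p q} → p ⊆ q → image φ p ⊆ image φ q
  image-mono φ {p} p⊆q y∈φp with ∈-image⁻ φ p y∈φp
  ... | x , x∈p , refl = ∈-image⁺ φ (p⊆q x∈p)

  image-bigUnion⊆ : ∀ (φ : Fin n → Fin n') (I : Subset s) S → image φ (bigUnion I S) ⊆ bigUnion I (image φ ∘ S)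
  image-bigUnion⊆ φ I S y∈φU with ∈-image⁻ φ (bigUnion I S) y∈φU
  ... | x , x∈U , refl with ∈-bigUnion⁻ I S x∈U
  ... | i , i∈I , x∈Si = ∈-bigUnion⁺ (image φ ∘ S) i∈I (∈-image⁺ φ x∈Si)

  ∣p∪q∣≤∣p∣+∣q∣ : ∀ (p q : Subset n) → ∣ p ∪ q ∣ ≤ ∣ p ∣ + ∣ q ∣
  ∣p∪q∣≤∣p∣+∣q∣ []          []          = z≤n
  ∣p∪q∣≤∣p∣+∣q∣ (true ∷ p)  (b ∷ q)     = s≤s (≤-trans (∣p∪q∣≤∣p∣+∣q∣ p q) (ℕ.+-monoʳ-≤ ∣ p ∣ (∣p∣≤∣x∷p∣ b q)))
  ∣p∪q∣≤∣p∣+∣q∣ (false ∷ p) (true ∷ q)  = ≤-trans (s≤s (∣p∪q∣≤∣p∣+∣q∣ p q)) (≤-reflexive (sym (ℕ.+-suc ∣ p ∣ ∣ q ∣)))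
  ∣p∪q∣≤∣p∣+∣q∣ (false ∷ p) (false ∷ q) = ∣p∪q∣≤∣p∣+∣q∣ p q

  ∣image∣≤∣p∣ : ∀ (φ : Fin n → Fin n') p → ∣ image φ p ∣ ≤ ∣ p ∣
  ∣image∣≤∣p∣ {n' = n'} φ p = ≤-trans (∣⋃-singletons∣≤ (elements p)) (≤-reflexive (length-elements p))
    where
    ∣⋃-singletons∣≤ : ∀ xs → ∣ ⋃ (map (⁅_⁆ ∘ φ) xs) ∣ ≤ length xs
    ∣⋃-singletons∣≤ []       = ≤-reflexive (∣⊥∣≡0 n')
    ∣⋃-singletons∣≤ (x ∷ xs) = ≤-trans (∣p∪q∣≤∣p∣+∣q∣ ⁅ φ x ⁆ _)
      (≤-trans (ℕ.+-monoʳ-≤ ∣ ⁅ φ x ⁆ ∣ (∣⋃-singletons∣≤ xs)) (≤-reflexive (cong (_+ length xs) (∣⁅x⁆∣≡1 (φ x)))))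

  ⁅x⁆∪p⊆q : ∀ {x : Fin n} {p q} → x ∈ q → p ⊆ q → ⁅ x ⁆ ∪ p ⊆ q
  ⁅x⁆∪p⊆q {x = x} {p} x∈q p⊆q z∈ with x∈p∪q⁻ ⁅ x ⁆ p z∈
  ... | inj₁ z∈⁅x⁆ rewrite x∈⁅y⁆⇒x≡y _ z∈⁅x⁆ = x∈q
  ... | inj₂ z∈p   = p⊆q z∈p

  ∣⁅x⁆∪p∣≤1+∣p∣ : ∀ (x : Fin n) p → ∣ ⁅ x ⁆ ∪ p ∣ ≤ suc ∣ p ∣
  ∣⁅x⁆∪p∣≤1+∣p∣ x p = ≤-trans (∣p∪q∣≤∣p∣+∣q∣ ⁅ x ⁆ p) (≤-reflexive (cong (_+ ∣ p ∣) (∣⁅x⁆∣≡1 x)))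

  keepFirst : ℕ → Subset n → Subset n
  keepFirst m       []          = []
  keepFirst m       (false ∷ p) = false ∷ keepFirst m p
  keepFirst zero    (true ∷ p)  = false ∷ keepFirst zero p
  keepFirst (suc m) (true ∷ p)  = true ∷ keepFirst m p

  keepFirst⊆ : ∀ m (p : Subset n) → keepFirst m p ⊆ p
  keepFirst⊆ m       (false ∷ p) (there x∈) = there (keepFirst⊆ m p x∈)
  keepFirst⊆ zero    (true ∷ p)  (there x∈) = there (keepFirst⊆ zero p x∈)
  keepFirst⊆ (suc m) (true ∷ p)  here       = here
  keepFirst⊆ (suc m) (true ∷ p)  (there x∈) = there (keepFirst⊆ m p x∈)

  ∣keepFirst∣ : ∀ m (p : Subset n) → ∣ keepFirst m p ∣ ≡ m ⊓ ∣ p ∣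
  ∣keepFirst∣ m       []          = sym (ℕ.⊓-zeroʳ m)
  ∣keepFirst∣ m       (false ∷ p) = ∣keepFirst∣ m p
  ∣keepFirst∣ zero    (true ∷ p)  = ∣keepFirst∣ zero p
  ∣keepFirst∣ (suc m) (true ∷ p)  = cong suc (∣keepFirst∣ m p)

  keepFirst-all : ∀ m (p : Subset n) → ∣ p ∣ ≤ m → keepFirst m p ≡ p
  keepFirst-all m       []          _         = refl
  keepFirst-all m       (false ∷ p) ∣p∣≤m     = cong (false ∷_) (keepFirst-all m p ∣p∣≤m)
  keepFirst-all (suc m) (true ∷ p)  (s≤s ∣p∣≤m) = cong (true ∷_) (keepFirst-all m p ∣p∣≤m)

  -- Collisions

  collisions : (Fin n → Fin n') → Subset n → Subset n
  collisions φ []      = []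
  collisions φ (a ∷ p) = (a ∧ lookup (image (φ ∘ suc) p) (φ zero)) ∷ collisions (φ ∘ suc) p

  ∈-collisions⁻ : ∀ (φ : Fin n → Fin n') p {x} → x ∈ collisions φ p →
                  x ∈ p × ∃[ y ] y ∈ p × x F.< y × φ y ≡ φ x
  ∈-collisions⁻ φ (a ∷ p) {zero} 0∈C
    with to T-∧ (∈⇒T-lookup 0∈C)
  ... | a-true , φ0∈φp with ∈-image⁻ (φ ∘ suc) p (T-lookup⇒∈ _ φ0∈φp)
  ...   | y , y∈p , φy≡φ0 = T-lookup⇒∈ (a ∷ p) a-true , suc y , there y∈p , s≤s z≤n , φy≡φ0
  ∈-collisions⁻ φ (a ∷ p) {suc x} x∈C
    with ∈-collisions⁻ (φ ∘ suc) p (drop-there x∈C)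
  ... | x∈p , y , y∈p , x<y , φy≡φx = there x∈p , suc y , there y∈p , s≤s x<y , φy≡φx

  ∈-collisions⁺ : ∀ (φ : Fin n → Fin n') {p x y} → x ∈ p → y ∈ p → x F.< y → φ y ≡ φ x → x ∈ collisions φ p
  ∈-collisions⁺ φ {a ∷ p} {zero} {suc y} x∈p y∈p _ φy≡φx =
    T-lookup⇒∈ (collisions φ (a ∷ p))
      (from T-∧ (∈⇒T-lookup x∈p , ∈⇒T-lookup (subst (_∈ image (φ ∘ suc) p) φy≡φx (∈-image⁺ (φ ∘ suc) (drop-there y∈p)))))
  ∈-collisions⁺ φ {a ∷ p} {suc x} {suc y} x∈p y∈p (s≤s x<y) φy≡φx =
    there (∈-collisions⁺ (φ ∘ suc) (drop-there x∈p) (drop-there y∈p) x<y φy≡φx)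

  collisions⊆ : ∀ (φ : Fin n → Fin n') p → collisions φ p ⊆ p
  collisions⊆ φ p = proj₁ ∘ ∈-collisions⁻ φ p

  collisions-mono : ∀ (φ : Fin n → Fin n') {p q} → p ⊆ q → collisions φ p ⊆ collisions φ q
  collisions-mono φ {p} p⊆q x∈C with ∈-collisions⁻ φ p x∈C
  ... | x∈p , y , y∈p , x<y , φy≡φx = ∈-collisions⁺ φ (p⊆q x∈p) (p⊆q y∈p) x<y φy≡φx

  image-tail⊆ : ∀ (φ : Fin (suc n) → Fin n') a p → image (φ ∘ suc) p ⊆ image φ (a ∷ p)
  image-tail⊆ φ a p y∈ with ∈-image⁻ (φ ∘ suc) p y∈
  ... | x , x∈p , refl = ∈-image⁺ φ {a ∷ p} (there x∈p)

  -- Every point of p either is the last preimage of its image, or a collision.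
  ∣p∣≤∣image∣+∣collisions∣ : ∀ (φ : Fin n → Fin n') p → ∣ p ∣ ≤ ∣ image φ p ∣ + ∣ collisions φ p ∣
  ∣p∣≤∣image∣+∣collisions∣ φ [] = z≤n
  ∣p∣≤∣image∣+∣collisions∣ φ (false ∷ p) =
    ≤-trans (∣p∣≤∣image∣+∣collisions∣ (φ ∘ suc) p) (ℕ.+-monoˡ-≤ _ (p⊆q⇒∣p∣≤∣q∣ (image-tail⊆ φ false p)))
  ∣p∣≤∣image∣+∣collisions∣ φ (true ∷ p)
    with lookup (image (φ ∘ suc) p) (φ zero) in φ0∈? | ∣p∣≤∣image∣+∣collisions∣ (φ ∘ suc) p
  ... | true  | ih = ≤-trans (s≤s (≤-trans ih (ℕ.+-monoˡ-≤ _ (p⊆q⇒∣p∣≤∣q∣ (image-tail⊆ φ true p)))))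
                             (≤-reflexive (sym (ℕ.+-suc _ _)))
  ... | false | ih = ≤-trans (s≤s ih) (ℕ.+-monoˡ-≤ _ (p⊂q⇒∣p∣<∣q∣ (image-tail⊆ φ true p , φ zero , ∈-image⁺ φ here , φ0∉)))
    where
    φ0∉ : φ zero ∉ image (φ ∘ suc) p
    φ0∉ φ0∈ = contradiction (trans (sym ([]=⇒lookup φ0∈)) φ0∈?) λ ()

  module _ (S : Fin s → Subset n) (φ : Fin n → Fin n') where

    -- A collision of ⋃_{i∈I} S_i survives in the union of the (at most two) sets containing its two points.
    collisions-of-few-sets : ∀ (I : Subset s) xs → All (_∈ collisions φ (bigUnion I S)) xs →
      ∃[ J ] J ⊆ I × ∣ J ∣ ≤ 2 * length xs × All (_∈ collisions φ (bigUnion J S)) xs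
    collisions-of-few-sets I [] [] = ⊥ , (λ i∈⊥ → ⊥-elim (∉⊥ i∈⊥)) , ≤-reflexive (∣⊥∣≡0 s) , []
    collisions-of-few-sets I (x ∷ xs) (x∈C ∷ xs⊆C)
      with ∈-collisions⁻ φ (bigUnion I S) x∈C | collisions-of-few-sets I xs xs⊆C
    ... | x∈U , y , y∈U , x<y , φy≡φx | J , J⊆I , ∣J∣≤ , xs⊆C'
      with ∈-bigUnion⁻ I S x∈U | ∈-bigUnion⁻ I S y∈U
    ... | a , a∈I , x∈Sa | b , b∈I , y∈Sb =
      ⁅ a ⁆ ∪ (⁅ b ⁆ ∪ J) ,
      ⁅x⁆∪p⊆q a∈I (⁅x⁆∪p⊆q b∈I J⊆I) ,
      ≤-trans (∣⁅x⁆∪p∣≤1+∣p∣ a _) (≤-trans (s≤s (∣⁅x⁆∪p∣≤1+∣p∣ b J))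
        (≤-trans (s≤s (s≤s ∣J∣≤)) (≤-reflexive (sym (ℕ.*-suc 2 (length xs)))))) ,
      ∈-collisions⁺ φ (∈-bigUnion⁺ S a∈J x∈Sa) (∈-bigUnion⁺ S b∈J y∈Sb) x<y φy≡φx ∷
      All.map (collisions-mono φ (bigUnion-mono S J⊆J')) xs⊆C'
      where
      a∈J : a ∈ ⁅ a ⁆ ∪ (⁅ b ⁆ ∪ J)
      a∈J = x∈p∪q⁺ (inj₁ (x∈⁅x⁆ a))
      b∈J : b ∈ ⁅ a ⁆ ∪ (⁅ b ⁆ ∪ J)
      b∈J = x∈p∪q⁺ (inj₂ (x∈p∪q⁺ (inj₁ (x∈⁅x⁆ b))))
      J⊆J' : J ⊆ ⁅ a ⁆ ∪ (⁅ b ⁆ ∪ J)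
      J⊆J' i∈J = x∈p∪q⁺ (inj₂ (x∈p∪q⁺ (inj₂ i∈J)))

    many-collisions-of-few-sets : ∀ (I : Subset s) k → k ≤ ∣ collisions φ (bigUnion I S) ∣ →
      ∃[ J ] J ⊆ I × ∣ J ∣ ≤ 2 * k × k ≤ ∣ collisions φ (bigUnion J S) ∣
    many-collisions-of-few-sets I k k≤∣C∣ =
      let (J , J⊆I , ∣J∣≤ , X⊆C′) = collisions-of-few-sets I (elements X) (All.tabulate (X⊆C ∘ ∈-elements⁻ X))
      in J , J⊆I , subst (λ l → ∣ J ∣ ≤ 2 * l) (trans (length-elements X) ∣X∣≡k) ∣J∣≤ ,
         subst (_≤ ∣ collisions φ (bigUnion J S) ∣) ∣X∣≡k (p⊆q⇒∣p∣≤∣q∣ (All.lookup X⊆C′ ∘ ∈-elements⁺ {p = X}))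
      where
      X = keepFirst k (collisions φ (bigUnion I S))
      X⊆C = keepFirst⊆ k (collisions φ (bigUnion I S))
      ∣X∣≡k : ∣ X ∣ ≡ k
      ∣X∣≡k = trans (∣keepFirst∣ k (collisions φ (bigUnion I S))) (ℕ.m≤n⇒m⊓n≡m k≤∣C∣)

  collisions-keepFirst : ∀ (φ : Fin n → Fin n') m k V → ∣ image φ (keepFirst (m + k) V) ∣ < m →
    k ≤ ∣ collisions φ V ∣ → k ≤ ∣ collisions φ (keepFirst (m + k) V) ∣
  collisions-keepFirst φ m k V ∣φA∣<m k≤∣C∣ with ℕ.≤-total ∣ V ∣ (m + k)
  ... | inj₁ ∣V∣≤m+k rewrite keepFirst-all (m + k) V ∣V∣≤m+k = k≤∣C∣
  ... | inj₂ m+k≤∣V∣ = ℕ.<⇒≤ (ℕ.+-cancelˡ-< m k _ (begin-strict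
    m + k                    ≡⟨ trans (∣keepFirst∣ (m + k) V) (ℕ.m≤n⇒m⊓n≡m m+k≤∣V∣) ⟨
    ∣ A ∣                    ≤⟨ ∣p∣≤∣image∣+∣collisions∣ φ A ⟩
    ∣ image φ A ∣ + ∣ collisions φ A ∣ <⟨ ℕ.+-monoˡ-< _ ∣φA∣<m ⟩
    m + ∣ collisions φ A ∣   ∎))
    where
    open ≤-Reasoning
    A = keepFirst (m + k) V

  subsets≤ : Subset n → ℕ → List (Subset n)
  subsets≤ []          m       = [ [] ]
  subsets≤ (false ∷ p) m       = map (false ∷_) (subsets≤ p m)
  subsets≤ (true ∷ p)  zero    = map (false ∷_) (subsets≤ p zero)
  subsets≤ (true ∷ p)  (suc m) = map (true ∷_) (subsets≤ p m) ++ map (false ∷_) (subsets≤ p (suc m))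

  ∈-subsets≤ : ∀ {X p : Subset n} m → X ⊆ p → ∣ X ∣ ≤ m → X ∈ₗ subsets≤ p m
  ∈-subsets≤ {X = []}        {[]}        m       _   _ = here refl
  ∈-subsets≤ {X = true ∷ X}  {false ∷ p} m       X⊆p _ with X⊆p here
  ... | ()
  ∈-subsets≤ {X = false ∷ X} {false ∷ p} m       X⊆p ∣X∣≤m = ∈-map⁺ (false ∷_) (∈-subsets≤ m (drop-∷-⊆ X⊆p) ∣X∣≤m)
  ∈-subsets≤ {X = false ∷ X} {true ∷ p}  zero    X⊆p ∣X∣≤m = ∈-map⁺ (false ∷_) (∈-subsets≤ zero (drop-∷-⊆ X⊆p) ∣X∣≤m)
  ∈-subsets≤ {X = false ∷ X} {true ∷ p}  (suc m) X⊆p ∣X∣≤m =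
    ∈-++⁺ʳ (map (true ∷_) (subsets≤ p m)) (∈-map⁺ (false ∷_) (∈-subsets≤ (suc m) (drop-∷-⊆ X⊆p) ∣X∣≤m))
  ∈-subsets≤ {X = true ∷ X}  {true ∷ p}  (suc m) X⊆p (s≤s ∣X∣≤m) =
    ∈-++⁺ˡ (∈-map⁺ (true ∷_) (∈-subsets≤ m (drop-∷-⊆ X⊆p) ∣X∣≤m))

  length-subsets≤ : ∀ r .{{_ : NonZero r}} (p : Subset n) m → r ^ ∣ p ∣ * length (subsets≤ p m) ≤ r ^ m * suc r ^ ∣ p ∣
  length-subsets≤ r []          m       = ≤-trans (ℕ.m^n>0 r m) (≤-reflexive (sym (ℕ.*-identityʳ (r ^ m))))
  length-subsets≤ r (false ∷ p) m       =
    subst (λ l → r ^ ∣ p ∣ * l ≤ r ^ m * suc r ^ ∣ p ∣) (sym (length-map (false ∷_) (subsets≤ p m))) (length-subsets≤ r p m)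
  length-subsets≤ r (true ∷ p)  zero    = begin
    r * r ^ ∣ p ∣ * length (map (false ∷_) (subsets≤ p zero))
      ≡⟨ cong (r * r ^ ∣ p ∣ *_) (length-map (false ∷_) (subsets≤ p zero)) ⟩
    r * r ^ ∣ p ∣ * length (subsets≤ p zero)   ≡⟨ ℕ.*-assoc r _ _ ⟩
    r * (r ^ ∣ p ∣ * length (subsets≤ p zero)) ≤⟨ ℕ.*-mono-≤ (ℕ.n≤1+n r) (length-subsets≤ r p zero) ⟩
    suc r * (1 * suc r ^ ∣ p ∣)                ≡⟨ cong (suc r *_) (ℕ.*-identityˡ _) ⟩
    suc r ^ suc ∣ p ∣                          ≡⟨ ℕ.*-identityˡ _ ⟨
    1 * suc r ^ suc ∣ p ∣                      ∎
    where open ≤-Reasoning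
  length-subsets≤ r (true ∷ p)  (suc m) = begin
    r * r ^ ∣ p ∣ * length (map (true ∷_) (subsets≤ p m) ++ map (false ∷_) (subsets≤ p (suc m)))
      ≡⟨ cong (r * r ^ ∣ p ∣ *_) (trans (length-++ (map (true ∷_) (subsets≤ p m)))
           (cong₂ _+_ (length-map (true ∷_) (subsets≤ p m)) (length-map (false ∷_) (subsets≤ p (suc m))))) ⟩
    r * r ^ ∣ p ∣ * (length (subsets≤ p m) + length (subsets≤ p (suc m)))
      ≡⟨ distribute r (r ^ ∣ p ∣) _ _ ⟩
    r * (r ^ ∣ p ∣ * length (subsets≤ p m)) + r * (r ^ ∣ p ∣ * length (subsets≤ p (suc m)))
      ≤⟨ ℕ.+-mono-≤ (ℕ.*-monoʳ-≤ r (length-subsets≤ r p m)) (ℕ.*-monoʳ-≤ r (length-subsets≤ r p (suc m))) ⟩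
    r * (r ^ m * suc r ^ ∣ p ∣) + r * (r ^ suc m * suc r ^ ∣ p ∣)
      ≡⟨ collect r (r ^ m) (suc r ^ ∣ p ∣) ⟩
    r ^ suc m * suc r ^ suc ∣ p ∣ ∎
    where
    open ≤-Reasoning
    distribute : ∀ a b x y → a * b * (x + y) ≡ a * (b * x) + a * (b * y)
    distribute = solve-∀
    collect : ∀ r a b → r * (a * b) + r * (r * a * b) ≡ r * a * (suc r * b)
    collect = solve-∀

  length-subsets≤′ : ∀ r .{{_ : NonZero r}} (p : Subset n) m {N} → ∣ p ∣ ≤ N →
    r ^ N * length (subsets≤ p m) ≤ r ^ m * suc r ^ N
  length-subsets≤′ r p m ∣p∣≤N with ℕ.m≤n⇒∃[o]m+o≡n ∣p∣≤N
  ... | d , refl = begin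
    r ^ (∣ p ∣ + d) * length (subsets≤ p m)      ≡⟨ cong (_* length (subsets≤ p m)) (ℕ.^-distribˡ-+-* r ∣ p ∣ d) ⟩
    r ^ ∣ p ∣ * r ^ d * length (subsets≤ p m)    ≡⟨ xy∙z≈y∙xz (r ^ ∣ p ∣) (r ^ d) _ ⟩
    r ^ d * (r ^ ∣ p ∣ * length (subsets≤ p m))  ≤⟨ ℕ.*-mono-≤ (ℕ.^-monoˡ-≤ d (ℕ.n≤1+n r)) (length-subsets≤ r p m) ⟩
    suc r ^ d * (r ^ m * suc r ^ ∣ p ∣)          ≡⟨ x∙yz≈y∙zx (suc r ^ d) (r ^ m) (suc r ^ ∣ p ∣) ⟩
    r ^ m * (suc r ^ ∣ p ∣ * suc r ^ d)          ≡⟨ cong (r ^ m *_) (ℕ.^-distribˡ-+-* (suc r) ∣ p ∣ d) ⟨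
    r ^ m * suc r ^ (∣ p ∣ + d)                  ∎
    where open ≤-Reasoning

  subsetsOfSize : Subset n → ℕ → List (Subset n)
  subsetsOfSize p m = filterᵇ (λ X → ∣ X ∣ ≡ᵇ m) (subsets≤ p m)

  ∈-subsetsOfSize⁺ : ∀ {X p : Subset n} → X ⊆ p → X ∈ₗ subsetsOfSize p ∣ X ∣
  ∈-subsetsOfSize⁺ {X = X} X⊆p =
    ∈-filter⁺ (T? ∘ (λ Y → ∣ Y ∣ ≡ᵇ ∣ X ∣)) (∈-subsets≤ ∣ X ∣ X⊆p ≤-refl) (ℕ.≡⇒≡ᵇ ∣ X ∣ ∣ X ∣ refl)

  ∈-subsetsOfSize⁻ : ∀ {X : Subset n} p m → X ∈ₗ subsetsOfSize p m → ∣ X ∣ ≡ m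
  ∈-subsetsOfSize⁻ {X = X} p m X∈ =
    ℕ.≡ᵇ⇒≡ ∣ X ∣ m (proj₂ (∈-filter⁻ (T? ∘ (λ Y → ∣ Y ∣ ≡ᵇ m)) {xs = subsets≤ p m} X∈))

  infix 4 _⊆ᵇ_
  _⊆ᵇ_ : Subset n → Subset n → Bool
  []          ⊆ᵇ []      = true
  (false ∷ p) ⊆ᵇ (_ ∷ q) = p ⊆ᵇ q
  (true ∷ p)  ⊆ᵇ (b ∷ q) = b ∧ (p ⊆ᵇ q)

  ⊆⇒⊆ᵇ : ∀ {p q : Subset n} → p ⊆ q → T (p ⊆ᵇ q)
  ⊆⇒⊆ᵇ {p = []}        {[]}    _   = _
  ⊆⇒⊆ᵇ {p = false ∷ p} {_ ∷ q} p⊆q = ⊆⇒⊆ᵇ (drop-∷-⊆ p⊆q)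
  ⊆⇒⊆ᵇ {p = true ∷ p}  {_ ∷ q} p⊆q = from T-∧ (∈⇒T-lookup (p⊆q here) , ⊆⇒⊆ᵇ (drop-∷-⊆ p⊆q))

  -- Each point of X must land in the image of the later points of A, of size ≤ L: probability ≤ (L / n')^∣X∣.
  count-covered : ∀ n (X A : Subset n) L → ∣ A ∣ ≤ L →
    count (λ φ → X ⊆ᵇ collisions φ A) (allMaps n n') * n' ^ ∣ X ∣ ≤ L ^ ∣ X ∣ * n' ^ n
  count-covered zero    []          []      L _ = ≤-refl
  count-covered {n'} (suc n) (false ∷ X) (a ∷ A) L ∣A∣≤L = begin
    count Q (allMaps (suc n) n') * n' ^ ∣ X ∣   ≤⟨ ℕ.*-monoˡ-≤ (n' ^ ∣ X ∣) any-value ⟩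
    n' * count P (allMaps n n') * n' ^ ∣ X ∣    ≡⟨ ℕ.*-assoc n' _ _ ⟩
    n' * (count P (allMaps n n') * n' ^ ∣ X ∣)  ≤⟨ ℕ.*-monoʳ-≤ n' (count-covered n X A L (≤-trans (∣p∣≤∣x∷p∣ a A) ∣A∣≤L)) ⟩
    n' * (L ^ ∣ X ∣ * n' ^ n)                  ≡⟨ x∙yz≈y∙xz n' (L ^ ∣ X ∣) (n' ^ n) ⟩
    L ^ ∣ X ∣ * n' ^ suc n                     ∎
    where
    open ≤-Reasoning
    Q = λ φ → (false ∷ X) ⊆ᵇ collisions φ (a ∷ A)
    P = λ f → X ⊆ᵇ collisions f A
    any-value : count Q (allMaps (suc n) n') ≤ n' * count P (allMaps n n')
    any-value = count-concatMap-map _ (allFin n') Q P (λ _ _ → true) n' (λ _ _ t → _ , t)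
      (λ _ → ≤-reflexive (trans (count-true (allFin n')) (length-tabulate id))) (allMaps n n')
  count-covered {n'} (suc n) (true ∷ X) (a ∷ A) L ∣A∣≤L = begin
    count Q (allMaps (suc n) n') * (n' * n' ^ ∣ X ∣)  ≤⟨ ℕ.*-monoˡ-≤ (n' * n' ^ ∣ X ∣) value-in-image ⟩
    L * count P (allMaps n n') * (n' * n' ^ ∣ X ∣)    ≡⟨ regroup L (count P (allMaps n n')) n' (n' ^ ∣ X ∣) ⟩
    L * (count P (allMaps n n') * n' ^ ∣ X ∣) * n'    ≤⟨ ℕ.*-monoˡ-≤ n' (ℕ.*-monoʳ-≤ L (count-covered n X A L ∣A∣≤L′)) ⟩
    L * (L ^ ∣ X ∣ * n' ^ n) * n'                     ≡⟨ regroup′ L (L ^ ∣ X ∣) (n' ^ n) n' ⟩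
    L ^ suc ∣ X ∣ * n' ^ suc n                        ∎
    where
    open ≤-Reasoning
    Q = λ φ → (true ∷ X) ⊆ᵇ collisions φ (a ∷ A)
    P = λ f → X ⊆ᵇ collisions f A
    ∣A∣≤L′ = ≤-trans (∣p∣≤∣x∷p∣ a A) ∣A∣≤L
    value-in-image : count Q (allMaps (suc n) n') ≤ L * count P (allMaps n n')
    value-in-image = count-concatMap-map _ (allFin n') Q P (λ f → lookup (image f A)) L
      (λ _ _ t → let (t₁ , t₂) = to T-∧ t in proj₂ (to T-∧ t₁) , t₂)
      (λ f → ≤-trans (≤-reflexive (length-elements (image f A))) (≤-trans (∣image∣≤∣p∣ f A) ∣A∣≤L′))
      (allMaps n n')
    regroup : ∀ l c m x → l * c * (m * x) ≡ l * (c * x) * m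
    regroup = solve-∀
    regroup′ : ∀ l x y m → l * (x * y) * m ≡ l * x * (m * y)
    regroup′ = solve-∀

  ^-suc-mean-value : ∀ r N → suc r ^ suc N ≤ r ^ suc N + suc N * suc r ^ N
  ^-suc-mean-value r zero    = ≤-reflexive (base r)
    where
    base : ∀ r → suc r * 1 ≡ r * 1 + 1 * 1
    base = solve-∀
  ^-suc-mean-value r (suc N) = begin
    suc r * suc r ^ suc N                                   ≤⟨ ℕ.*-monoʳ-≤ (suc r) (^-suc-mean-value r N) ⟩
    suc r * (r ^ suc N + suc N * suc r ^ N)                 ≡⟨ expand r (r ^ suc N) N (suc r ^ N) ⟩
    r ^ suc (suc N) + r ^ suc N + suc N * suc r ^ suc N
      ≤⟨ ℕ.+-monoˡ-≤ _ (ℕ.+-monoʳ-≤ (r ^ suc (suc N)) (ℕ.^-monoˡ-≤ (suc N) (ℕ.n≤1+n r))) ⟩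
    r ^ suc (suc N) + suc r ^ suc N + suc N * suc r ^ suc N ≡⟨ ℕ.+-assoc (r ^ suc (suc N)) _ _ ⟩
    r ^ suc (suc N) + suc (suc N) * suc r ^ suc N           ∎
    where
    open ≤-Reasoning
    expand : ∀ r x N y → suc r * (x + suc N * y) ≡ r * x + x + suc N * (suc r * y)
    expand = solve-∀

  suc^≤2*^ : ∀ r N → 2 * N ≤ suc r → suc r ^ N ≤ 2 * r ^ N
  suc^≤2*^ r zero    _   = s≤s z≤n
  suc^≤2*^ r (suc N) 2N≤ = ℕ.+-cancelʳ-≤ X X (2 * r ^ suc N) (begin
    X + X                                 ≡⟨ double X ⟩
    2 * X                                 ≤⟨ ℕ.*-monoʳ-≤ 2 (^-suc-mean-value r N) ⟩
    2 * (r ^ suc N + suc N * suc r ^ N)   ≡⟨ distribute (r ^ suc N) (suc N) (suc r ^ N) ⟩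
    2 * r ^ suc N + 2 * suc N * suc r ^ N ≤⟨ ℕ.+-monoʳ-≤ (2 * r ^ suc N) (ℕ.*-monoˡ-≤ (suc r ^ N) 2N≤) ⟩
    2 * r ^ suc N + X                     ∎)
    where
    open ≤-Reasoning
    X = suc r ^ suc N
    double : ∀ x → x + x ≡ 2 * x
    double = solve-∀
    distribute : ∀ a b c → 2 * (a + b * c) ≡ 2 * a + 2 * b * c
    distribute = solve-∀

  suc^≤2^*^ : ∀ r .{{_ : NonZero r}} h t {N} → 2 * h ≤ suc r → N ≤ h * t → suc r ^ N ≤ 2 ^ t * r ^ N
  suc^≤2^*^ r h t {N} 2h≤ N≤ht with ℕ.m≤n⇒∃[o]m+o≡n N≤ht
  ... | d , N+d≡ht = ℕ.*-cancelʳ-≤ (suc r ^ N) (2 ^ t * r ^ N) (r ^ d) {{ℕ.m^n≢0 r d}} (begin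
    suc r ^ N * r ^ d           ≤⟨ ℕ.*-monoʳ-≤ (suc r ^ N) (ℕ.^-monoˡ-≤ d (ℕ.n≤1+n r)) ⟩
    suc r ^ N * suc r ^ d       ≡⟨ trans (sym (ℕ.^-distribˡ-+-* (suc r) N d)) (cong (suc r ^_) N+d≡ht) ⟩
    suc r ^ (h * t)             ≤⟨ chunks t ⟩
    2 ^ t * r ^ (h * t)         ≡⟨ cong (λ e → 2 ^ t * r ^ e) N+d≡ht ⟨
    2 ^ t * r ^ (N + d)         ≡⟨ trans (cong (2 ^ t *_) (ℕ.^-distribˡ-+-* r N d)) (sym (ℕ.*-assoc (2 ^ t) _ _)) ⟩
    2 ^ t * r ^ N * r ^ d       ∎)
    where
    open ≤-Reasoning
    chunks : ∀ t → suc r ^ (h * t) ≤ 2 ^ t * r ^ (h * t)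
    chunks zero    rewrite ℕ.*-zeroʳ h = s≤s z≤n
    chunks (suc t) rewrite ℕ.*-suc h t | ℕ.^-distribˡ-+-* (suc r) h (h * t) | ℕ.^-distribˡ-+-* r h (h * t) =
      ≤-trans (ℕ.*-mono-≤ (suc^≤2*^ r h 2h≤) (chunks t)) (≤-reflexive (interchange 2 (r ^ h) (2 ^ t) _))

  ^-distribʳ-* : ∀ m n o → (m * n) ^ o ≡ m ^ o * n ^ o
  ^-distribʳ-* m n zero    = refl
  ^-distribʳ-* m n (suc o) = trans (cong (m * n *_) (^-distribʳ-* m n o)) (interchange m n (m ^ o) (n ^ o))

  n<2^n : ∀ n → n < 2 ^ n
  n<2^n zero    = s≤s z≤n
  n<2^n (suc n) = ≤-trans (s≤s (n<2^n n))
    (≤-trans (ℕ.+-monoˡ-≤ (2 ^ n) (ℕ.m^n>0 2 n)) (≤-reflexive (cong (2 ^ n +_) (sym (ℕ.+-identityʳ (2 ^ n))))))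

  -- The factor 2^k gained from n' ≥ 2X absorbs b ≤ k.
  geometric-tail : ∀ {c M} n' X k b .{{_ : NonZero X}} → n' ^ k * c ≤ X ^ k * M → 2 * X ≤ n' → b ≤ k → b * c ≤ M
  geometric-tail {c} {M} n' X k b n'^k*c≤ 2X≤n' b≤k = ℕ.*-cancelˡ-≤ (n' ^ k) {{ℕ.m^n≢0 n' k {{n'≢0}}}} (begin
    n' ^ k * (b * c)    ≡⟨ x∙yz≈y∙xz (n' ^ k) b c ⟩
    b * (n' ^ k * c)    ≤⟨ ℕ.*-mono-≤ (ℕ.<⇒≤ (ℕ.≤-<-trans b≤k (n<2^n k))) n'^k*c≤ ⟩
    2 ^ k * (X ^ k * M) ≡⟨ ℕ.*-assoc (2 ^ k) _ _ ⟨
    2 ^ k * X ^ k * M   ≡⟨ cong (_* M) (^-distribʳ-* 2 X k) ⟨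
    (2 * X) ^ k * M     ≤⟨ ℕ.*-monoˡ-≤ M (ℕ.^-monoˡ-≤ k 2X≤n') ⟩
    n' ^ k * M          ∎)
    where
    open ≤-Reasoning
    n'≢0 : NonZero n'
    n'≢0 = ℕ.>-nonZero (≤-trans (ℕ.m≤n*m 1 2 {{_}}) (≤-trans (ℕ.*-monoʳ-≤ 2 (ℕ.>-nonZero⁻¹ X)) 2X≤n'))

  -- The union bound

  -- ∣⋃ φ(S_i)∣ < min (∣⋃ S_i∣ - k) s: the inequality fails at I, with k ≤ ε s in place of ε s.
  Lossy : (Fin s → Subset n) → (Fin n → Fin n') → ℕ → Subset s → Set
  Lossy {s} S φ k I = ∣ W ∣ < s × ∣ W ∣ + k < ∣ bigUnion I S ∣
    where W = bigUnion I (image φ ∘ S)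

  module _ (S : Fin s → Subset n) (k : ℕ) where

    truncatedUnion : Subset s → Subset n
    truncatedUnion J = keepFirst (s + k) (bigUnion J S)

    ∣truncatedUnion∣≤ : ∀ J → ∣ truncatedUnion J ∣ ≤ s + k
    ∣truncatedUnion∣≤ J = ≤-trans (≤-reflexive (∣keepFirst∣ (s + k) (bigUnion J S))) (ℕ.m⊓n≤m (s + k) _)

    witnessesOf : Subset s → List (Subset n × Subset n)
    witnessesOf J = map (truncatedUnion J ,_) (subsetsOfSize (truncatedUnion J) k)

    witnesses : List (Subset n × Subset n)
    witnesses = concatMap witnessesOf (subsets≤ (⊤ {s}) (2 * k))

    covered : (Fin n → Fin n') → Subset n × Subset n → Bool
    covered φ (A , X) = X ⊆ᵇ collisions φ A

    lossy⇒covered : ∀ (φ : Fin n → Fin n') {I} → Lossy S φ k I → ∃[ w ] w ∈ₗ witnesses × T (covered φ w)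
    lossy⇒covered φ {I} (∣W∣<s , ∣W∣+k<∣U∣) with many-collisions-of-few-sets S φ I k k≤∣C∣
      where
      U = bigUnion I S
      k≤∣C∣ : k ≤ ∣ collisions φ U ∣
      k≤∣C∣ = ℕ.<⇒≤ (ℕ.+-cancelˡ-< _ k _ (ℕ.<-≤-trans ∣W∣+k<∣U∣ (≤-trans (∣p∣≤∣image∣+∣collisions∣ φ U)
                (ℕ.+-monoˡ-≤ _ (p⊆q⇒∣p∣≤∣q∣ (image-bigUnion⊆ φ I S))))))
    ... | J , J⊆I , ∣J∣≤2k , k≤∣C′∣ = (A , X) , A,X∈witnesses , ⊆⇒⊆ᵇ X⊆C
      where
      A = truncatedUnion J
      X = keepFirst k (collisions φ A)
      X⊆C = keepFirst⊆ k (collisions φ A)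
      ∣φA∣<s : ∣ image φ A ∣ < s
      ∣φA∣<s = ℕ.≤-<-trans
        (p⊆q⇒∣p∣≤∣q∣ (image-bigUnion⊆ φ I S ∘ image-mono φ (bigUnion-mono S J⊆I ∘ keepFirst⊆ (s + k) _))) ∣W∣<s
      ∣X∣≡k : ∣ X ∣ ≡ k
      ∣X∣≡k = trans (∣keepFirst∣ k (collisions φ A))
                    (ℕ.m≤n⇒m⊓n≡m (collisions-keepFirst φ s k (bigUnion J S) ∣φA∣<s k≤∣C′∣))
      A,X∈witnesses : (A , X) ∈ₗ witnesses
      A,X∈witnesses = ∈-concatMap⁺ witnessesOf (lose (∈-subsets≤ {X = J} (2 * k) (λ _ → ∈⊤) ∣J∣≤2k)
        (∈-map⁺ (A ,_) (subst (λ m → X ∈ₗ subsetsOfSize A m) ∣X∣≡k (∈-subsetsOfSize⁺ (collisions⊆ φ A ∘ X⊆C)))))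

    ∈-witnesses⁻ : ∀ {A X} → (A , X) ∈ₗ witnesses → ∣ A ∣ ≤ s + k × ∣ X ∣ ≡ k
    ∈-witnesses⁻ A,X∈ with find (∈-concatMap⁻ witnessesOf {xs = subsets≤ (⊤ {s}) (2 * k)} A,X∈)
    ... | J , _ , A,X∈J with ∈-map⁻ (truncatedUnion J ,_) A,X∈J
    ... | X , X∈ , refl = ∣truncatedUnion∣≤ J , ∈-subsetsOfSize⁻ (truncatedUnion J) k X∈

    count-lossy : ∀ (bad : (Fin n → Fin n') → Bool) → (∀ {φ} → T (bad φ) → ∃[ I ] Lossy S φ k I) →
      n' ^ k * count bad (allMaps n n') ≤ length witnesses * ((s + k) ^ k * n' ^ n)
    count-lossy {n'} bad bad⇒lossy =
      ≤-trans (ℕ.*-monoʳ-≤ (n' ^ k) (union-bound bad (λ w φ → covered φ w) witnesses bad⇒covered (allMaps n n')))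
              (*-sum-≤ (n' ^ k) (λ w → count (λ φ → covered φ w) (allMaps n n')) _ witnesses bound)
      where
      bad⇒covered : ∀ {φ} → T (bad φ) → ∃[ w ] w ∈ₗ witnesses × T (covered φ w)
      bad⇒covered bad-φ = let (I , lossy) = bad⇒lossy bad-φ in lossy⇒covered _ {I} lossy
      bound : ∀ {w} → w ∈ₗ witnesses → n' ^ k * count (λ φ → covered φ w) (allMaps n n') ≤ (s + k) ^ k * n' ^ n
      bound {A , X} w∈ with ∈-witnesses⁻ w∈
      ... | ∣A∣≤s+k , refl = ≤-trans (≤-reflexive (ℕ.*-comm (n' ^ ∣ X ∣) _)) (count-covered n X A (s + k) ∣A∣≤s+k)

    length-witnesses : ∀ r .{{_ : NonZero r}} →
      r ^ s * (r ^ (s + k) * length witnesses) ≤ r ^ (2 * k) * suc r ^ s * (r ^ k * suc r ^ (s + k))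
    length-witnesses r = begin
      r ^ s * (r ^ (s + k) * length witnesses)
        ≡⟨ cong (λ l → r ^ s * (r ^ (s + k) * l)) (length-concatMap witnessesOf Js) ⟩
      r ^ s * (r ^ (s + k) * sum (map (length ∘ witnessesOf) Js))
        ≤⟨ ℕ.*-monoʳ-≤ (r ^ s) (*-sum-≤ (r ^ (s + k)) (length ∘ witnessesOf) _ Js (λ {J} _ → perSet J)) ⟩
      r ^ s * (length Js * (r ^ k * suc r ^ (s + k)))
        ≡⟨ ℕ.*-assoc (r ^ s) _ _ ⟨
      r ^ s * length Js * (r ^ k * suc r ^ (s + k))
        ≤⟨ ℕ.*-monoˡ-≤ _ (length-subsets≤′ r (⊤ {s}) (2 * k) (≤-reflexive (∣⊤∣≡n s))) ⟩
      r ^ (2 * k) * suc r ^ s * (r ^ k * suc r ^ (s + k)) ∎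
      where
      open ≤-Reasoning
      Js = subsets≤ (⊤ {s}) (2 * k)
      perSet : ∀ J → r ^ (s + k) * length (witnessesOf J) ≤ r ^ k * suc r ^ (s + k)
      perSet J = ≤-trans (ℕ.*-monoʳ-≤ (r ^ (s + k)) (≤-trans (≤-reflexive (length-map _ (subsetsOfSize A k)))
                                                              (length-filter _ (subsets≤ A k))))
                         (length-subsets≤′ r A k (∣truncatedUnion∣≤ J))
        where A = truncatedUnion J

  length-witnesses≤ : ∀ (S : Fin s → Subset n) k h .{{_ : NonZero h}} → s + (s + k) ≤ h * (5 * k) →
    length (witnesses S k) ≤ (32 * (2 * h) ^ 3) ^ k
  length-witnesses≤ {s} S k h N≤5kh = ℕ.*-cancelʳ-≤ _ _ (r ^ N) {{ℕ.m^n≢0 r N}} (begin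
    length (witnesses S k) * r ^ N
      ≡⟨ ℕ.*-comm _ (r ^ N) ⟩
    r ^ N * length (witnesses S k)
      ≡⟨ trans (cong (_* _) (ℕ.^-distribˡ-+-* r s (s + k))) (ℕ.*-assoc (r ^ s) _ _) ⟩
    r ^ s * (r ^ (s + k) * length (witnesses S k))
      ≤⟨ length-witnesses S k r ⟩
    r ^ (2 * k) * suc r ^ s * (r ^ k * suc r ^ (s + k))
      ≡⟨ interchange (r ^ (2 * k)) (suc r ^ s) (r ^ k) _ ⟩
    r ^ (2 * k) * r ^ k * (suc r ^ s * suc r ^ (s + k))
      ≡⟨ cong (r ^ (2 * k) * r ^ k *_) (ℕ.^-distribˡ-+-* (suc r) s (s + k)) ⟨
    r ^ (2 * k) * r ^ k * suc r ^ N
      ≤⟨ ℕ.*-monoʳ-≤ (r ^ (2 * k) * r ^ k) (suc^≤2^*^ r h (5 * k) (ℕ.n≤1+n r) N≤5kh) ⟩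
    r ^ (2 * k) * r ^ k * (2 ^ (5 * k) * r ^ N)
      ≡⟨ ℕ.*-assoc (r ^ (2 * k) * r ^ k) (2 ^ (5 * k)) (r ^ N) ⟨
    r ^ (2 * k) * r ^ k * 2 ^ (5 * k) * r ^ N
      ≡⟨ cong (_* r ^ N) powers ⟨
    (32 * r ^ 3) ^ k * r ^ N ∎)
    where
    open ≤-Reasoning
    r = 2 * h
    instance
      r≢0 : NonZero r
      r≢0 = ℕ.m*n≢0 2 h
    N = s + (s + k)
    powers : (32 * r ^ 3) ^ k ≡ r ^ (2 * k) * r ^ k * 2 ^ (5 * k)
    powers = begin-equality
      (32 * r ^ 3) ^ k                    ≡⟨ ^-distribʳ-* 32 (r ^ 3) k ⟩
      32 ^ k * (r ^ 3) ^ k                ≡⟨ cong₂ _*_ (ℕ.^-*-assoc 2 5 k) (ℕ.^-*-assoc r 3 k) ⟩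
      2 ^ (5 * k) * r ^ (3 * k)           ≡⟨ cong (λ e → 2 ^ (5 * k) * r ^ e) (ℕ.+-comm k (2 * k)) ⟩
      2 ^ (5 * k) * r ^ (2 * k + k)       ≡⟨ cong (2 ^ (5 * k) *_) (ℕ.^-distribˡ-+-* r (2 * k) k) ⟩
      2 ^ (5 * k) * (r ^ (2 * k) * r ^ k) ≡⟨ ℕ.*-comm (2 ^ (5 * k)) _ ⟩
      r ^ (2 * k) * r ^ k * 2 ^ (5 * k)   ∎

  m<[1+m/n]*n : ∀ m n .{{_ : NonZero n}} → m < suc (m / n) * n
  m<[1+m/n]*n m n = begin-strict
    m                 ≡⟨ m≡m%n+[m/n]*n m n ⟩
    m % n + m / n * n <⟨ ℕ.+-monoˡ-< (m / n * n) (m%n<n m n) ⟩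
    n + m / n * n     ∎
    where open ≤-Reasoning

  -- For ε = p / q:  k = ⌊ε s⌋  and  h = ⌊1/ε⌋ + 1.
  module Parameters (p q s : ℕ) .{{_ : NonZero p}} .{{_ : NonZero q}} where

    k : ℕ
    k = p * s / q

    h : ℕ
    h = suc (q / p)

    k*q≤p*s : k * q ≤ p * s
    k*q≤p*s = m/n*n≤m (p * s) q

    b≤k : ∀ b → b * q ≤ s → b ≤ k
    b≤k b bq≤s = begin
      b         ≡⟨ m*n/n≡m b q ⟨
      b * q / q ≤⟨ /-monoˡ-≤ q (≤-trans bq≤s (ℕ.m≤n*m s p)) ⟩
      p * s / q ∎
      where open ≤-Reasoning

    k≤s : p ≤ q → k ≤ s
    k≤s p≤q = ℕ.*-cancelʳ-≤ k s q (≤-trans k*q≤p*s (≤-trans (ℕ.*-monoˡ-≤ s p≤q) (≤-reflexive (ℕ.*-comm q s))))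

    h*p≤2*q : p ≤ q → h * p ≤ 2 * q
    h*p≤2*q p≤q = ≤-trans (ℕ.+-mono-≤ p≤q (m/n*n≤m q p)) (≤-reflexive (cong (q +_) (sym (ℕ.+-identityʳ q))))

    s+[s+k]≤h*5k : 1 ≤ k → s + (s + k) ≤ h * (5 * k)
    s+[s+k]≤h*5k 1≤k = ≤-trans (ℕ.+-mono-≤ (ℕ.<⇒≤ s<2kh) (ℕ.+-mono-≤ (ℕ.<⇒≤ s<2kh) (ℕ.m≤m*n k h)))
                               (≤-reflexive (collect k h))
      where
      open ≤-Reasoning
      s<2kh : s < 2 * k * h
      s<2kh = ℕ.*-cancelˡ-< p s (2 * k * h) (begin-strict
        p * s           <⟨ m<[1+m/n]*n (p * s) q ⟩
        suc k * q       ≤⟨ ℕ.*-monoˡ-≤ q (≤-trans (ℕ.+-monoˡ-≤ k 1≤k) (≤-reflexive (cong (k +_) (sym (ℕ.+-identityʳ k))))) ⟩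
        2 * k * q       ≤⟨ ℕ.*-monoʳ-≤ (2 * k) (ℕ.<⇒≤ (m<[1+m/n]*n q p)) ⟩
        2 * k * (h * p) ≡⟨ rearrange k h p ⟩
        p * (2 * k * h) ∎)
        where
        rearrange : ∀ k h p → 2 * k * (h * p) ≡ p * (2 * k * h)
        rearrange = solve-∀
      collect : ∀ k h → 2 * k * h + (2 * k * h + k * h) ≡ h * (5 * k)
      collect = solve-∀

    2*[32*[2h]³*[s+k]]≤n' : ∀ {n'} → p ≤ q → 8192 * s * (q * q * q) ≤ p * p * p * n' →
      2 * (32 * (2 * h) ^ 3 * (s + k)) ≤ n'
    2*[32*[2h]³*[s+k]]≤n' {n'} p≤q n'-large = ℕ.*-cancelʳ-≤ _ n' (p * p * p) {{ℕ.m*n≢0 (p * p) p {{ℕ.m*n≢0 p p}}}} (begin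
      2 * (32 * (2 * h) ^ 3 * (s + k)) * (p * p * p)
        ≤⟨ ℕ.*-monoˡ-≤ (p * p * p) (ℕ.*-monoʳ-≤ 2 (ℕ.*-monoʳ-≤ (32 * (2 * h) ^ 3) (ℕ.+-monoʳ-≤ s (k≤s p≤q)))) ⟩
      2 * (32 * (2 * h) ^ 3 * (s + s)) * (p * p * p)  ≡⟨ expand h s p ⟩
      1024 * s * ((h * p) * (h * p) * (h * p))       ≤⟨ ℕ.*-monoʳ-≤ (1024 * s) (ℕ.*-mono-≤ (ℕ.*-mono-≤ hp≤2q hp≤2q) hp≤2q) ⟩
      1024 * s * ((2 * q) * (2 * q) * (2 * q))       ≡⟨ collect s q ⟩
      8192 * s * (q * q * q)                          ≤⟨ n'-large ⟩
      p * p * p * n'                                  ≡⟨ ℕ.*-comm (p * p * p) n' ⟩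
      n' * (p * p * p)                                ∎)
      where
      open ≤-Reasoning
      hp≤2q = h*p≤2*q p≤q
      -- (2 * x) ^ 3 spelled out as it unfolds definitionally, since the ring solver rejects _^_ here.
      expand : ∀ x y z → 2 * (32 * (2 * x * (2 * x * (2 * x * 1))) * (y + y)) * (z * z * z)
                       ≡ 1024 * y * ((x * z) * (x * z) * (x * z))
      expand = solve-∀
      collect : ∀ x y → 1024 * x * ((2 * y) * (2 * y) * (2 * y)) ≡ 8192 * x * (y * y * y)
      collect = solve-∀

  lossy-maps-rare : ∀ (S : Fin s → Subset n) (bad : (Fin n → Fin n') → Bool) p q b
    .{{_ : NonZero p}} .{{_ : NonZero q}} .{{_ : NonZero b}} →
    p ≤ q → b * q ≤ s → 8192 * s * (q * q * q) ≤ p * p * p * n' →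
    (∀ {φ} → T (bad φ) → ∃[ I ] Lossy S φ (Parameters.k p q s) I) →
    b * count bad (allMaps n n') ≤ n' ^ n
  lossy-maps-rare {s} {n} {n'} S bad p q b p≤q b*q≤s n'-large bad⇒lossy =
    geometric-tail n' X k b {{X≢0}} n'^k*count≤ (2*[32*[2h]³*[s+k]]≤n' p≤q n'-large) b≤k′
    where
    open Parameters p q s
    open ≤-Reasoning
    b≤k′ = b≤k b b*q≤s
    X = 32 * (2 * h) ^ 3 * (s + k)
    X≢0 : NonZero X
    X≢0 = ℕ.m*n≢0 (32 * (2 * h) ^ 3) (s + k) {{ℕ.m*n≢0 32 _ {{_}} {{ℕ.m^n≢0 (2 * h) 3}}}}
                  {{ℕ.>-nonZero (≤-trans (ℕ.>-nonZero⁻¹ b) (≤-trans b≤k′ (ℕ.m≤n+m k s)))}}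
    n'^k*count≤ : n' ^ k * count bad (allMaps n n') ≤ X ^ k * n' ^ n
    n'^k*count≤ = begin
      n' ^ k * count bad (allMaps n n')                ≤⟨ count-lossy S k bad bad⇒lossy ⟩
      length (witnesses S k) * ((s + k) ^ k * n' ^ n)  ≤⟨ ℕ.*-monoˡ-≤ _ (length-witnesses≤ S k h (s+[s+k]≤h*5k
                                                            (≤-trans (ℕ.>-nonZero⁻¹ b) b≤k′))) ⟩
      (32 * (2 * h) ^ 3) ^ k * ((s + k) ^ k * n' ^ n)  ≡⟨ ℕ.*-assoc ((32 * (2 * h) ^ 3) ^ k) ((s + k) ^ k) (n' ^ n) ⟨
      (32 * (2 * h) ^ 3) ^ k * (s + k) ^ k * n' ^ n    ≡⟨ cong (_* n' ^ n) (^-distribʳ-* (32 * (2 * h) ^ 3) (s + k) k) ⟨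
      X ^ k * n' ^ n                                   ∎

open Counting

open import Data.Nat using (ℕ; _≥_; _^_)
open import Data.Fin using (Fin)
open import Data.Fin.Subset using (Subset; ∣_∣)
open import Data.Rational using (ℚ; 0ℚ; 1ℚ; _<_; _≤_; _*_)
open import Data.Product using (Σ; _×_)

import Data.Nat as ℕ
import Data.Nat.Properties as ℕ
import Data.Nat.Coprimality as Coprime
import Data.Integer as ℤ
import Data.Integer.Properties as ℤ
import Data.Rational as ℚ
import Data.Rational.Properties as ℚ
import Data.Rational.Unnormalised as ℚᵘ
import Data.Rational.Unnormalised.Properties as ℚᵘ
open import Data.Rational.Solver using (module +-*-Solver)
open import Algebra.Bundles using (CommutativeRing)
open import Algebra.Properties.CommutativeSemigroup (CommutativeRing.*-commutativeSemigroup ℚ.+-*-commutativeRing)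
  using (xy∙z≈xz∙y)
open import Data.Bool using (T; not)
open import Data.Bool.Properties using (T-not-≡)
open import Data.List.Relation.Unary.All using (All)
open import Data.List.Relation.Unary.All.Properties using (all⁻)
open import Data.List.Relation.Unary.All.Properties.Core using (¬All⇒Any¬)
open import Data.List.Relation.Unary.Any using (satisfied)
open import Data.Product using (_,_; ∃-syntax; map₂)
open import Function using (_∘_; Equivalence)
open import Relation.Nullary using (¬_)
open import Relation.Nullary.Decidable using (T?; fromWitness)
open import Relation.Binary.PropositionalEquality
  using (_≡_; refl; sym; trans; cong; cong₂; subst; subst₂; module ≡-Reasoning)

-- From ℚ to ℕ

ℕ→ℚ≡mkℚ : ∀ m → ℕ→ℚ m ≡ ℚ.mkℚ (ℤ.+ m) 0 (Coprime.sym (Coprime.1-coprimeTo m))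
ℕ→ℚ≡mkℚ m = ℚ.normalize-coprime _

ℕ→ℚ-mono-≤ : ∀ {m n} → m ℕ.≤ n → ℕ→ℚ m ≤ ℕ→ℚ n
ℕ→ℚ-mono-≤ {m} {n} m≤n rewrite ℕ→ℚ≡mkℚ m | ℕ→ℚ≡mkℚ n =
  ℚ.*≤* (subst₂ ℤ._≤_ (sym (ℤ.*-identityʳ (ℤ.+ m))) (sym (ℤ.*-identityʳ (ℤ.+ n))) (ℤ.+≤+ m≤n))

ℕ→ℚ-cancel-≤ : ∀ {m n} → ℕ→ℚ m ≤ ℕ→ℚ n → m ℕ.≤ n
ℕ→ℚ-cancel-≤ {m} {n} m≤n rewrite ℕ→ℚ≡mkℚ m | ℕ→ℚ≡mkℚ n with m≤n
... | ℚ.*≤* m*1≤n*1 = ℤ.drop‿+≤+ (subst₂ ℤ._≤_ (ℤ.*-identityʳ (ℤ.+ m)) (ℤ.*-identityʳ (ℤ.+ n)) m*1≤n*1)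

ℕ→ℚ-cancel-< : ∀ {m n} → ℕ→ℚ m < ℕ→ℚ n → m ℕ.< n
ℕ→ℚ-cancel-< {m} {n} m<n rewrite ℕ→ℚ≡mkℚ m | ℕ→ℚ≡mkℚ n with m<n
... | ℚ.*<* m*1<n*1 = ℤ.drop‿+<+ (subst₂ ℤ._<_ (ℤ.*-identityʳ (ℤ.+ m)) (ℤ.*-identityʳ (ℤ.+ n)) m*1<n*1)

ℕ→ℚ-homo-* : ∀ m n → ℕ→ℚ (m ℕ.* n) ≡ ℕ→ℚ m * ℕ→ℚ n
ℕ→ℚ-homo-* m n rewrite ℕ→ℚ≡mkℚ m | ℕ→ℚ≡mkℚ n = cong (ℚ._/ 1) (ℤ.pos-* m n)

ℕ→ℚ-homo-+ : ∀ m n → ℕ→ℚ (m ℕ.+ n) ≡ ℕ→ℚ m ℚ.+ ℕ→ℚ n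
ℕ→ℚ-homo-+ m n rewrite ℕ→ℚ≡mkℚ m | ℕ→ℚ≡mkℚ n =
  cong (ℚ._/ 1) (trans (ℤ.pos-+ m n) (sym (cong₂ ℤ._+_ (ℤ.*-identityʳ (ℤ.+ m)) (ℤ.*-identityʳ (ℤ.+ n)))))

ℕ→ℚ-pos : ∀ q .{{_ : ℕ.NonZero q}} → ℚ.Positive (ℕ→ℚ q)
ℕ→ℚ-pos (ℕ.suc q) rewrite ℕ→ℚ≡mkℚ (ℕ.suc q) = _

positive⇒fraction : ∀ {x} → 0ℚ < x → ∃[ p ] ∃[ q ] x * ℕ→ℚ (ℕ.suc q) ≡ ℕ→ℚ (ℕ.suc p)
positive⇒fraction {x} 0<x with ℚ.positive 0<x
positive⇒fraction {ℚ.mkℚ ℤ.+[1+ p ] q coprime} _ | _ =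
  p , q , ℚ.toℚᵘ-injective (ℚᵘ.≃-trans (ℚ.toℚᵘ-homo-* (ℚ.mkℚ ℤ.+[1+ p ] q coprime) (ℕ→ℚ (ℕ.suc q))) cross)
  where
  cross : ℚ.toℚᵘ (ℚ.mkℚ ℤ.+[1+ p ] q coprime) ℚᵘ.* ℚ.toℚᵘ (ℕ→ℚ (ℕ.suc q)) ℚᵘ.≃ ℚ.toℚᵘ (ℕ→ℚ (ℕ.suc p))
  cross rewrite ℕ→ℚ≡mkℚ (ℕ.suc q) | ℕ→ℚ≡mkℚ (ℕ.suc p) =
    ℚᵘ.*≡* (trans (ℤ.*-identityʳ _) (cong (λ d → ℤ.+[1+ p ] ℤ.* ℤ.+ ℕ.suc d) (sym (ℕ.*-identityʳ q))))

module _ (x : ℚ) (p q : ℕ) .{{_ : ℕ.NonZero q}} (x*q≡p : x * ℕ→ℚ q ≡ ℕ→ℚ p) where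

  ≤-cross⁺ : ∀ {m n} → m ℕ.* q ℕ.≤ p ℕ.* n → ℕ→ℚ m ≤ x * ℕ→ℚ n
  ≤-cross⁺ {m} {n} mq≤pn = ℚ.*-cancelʳ-≤-pos (ℕ→ℚ q) {{ℕ→ℚ-pos q}} (begin
    ℕ→ℚ m * ℕ→ℚ q       ≡⟨ ℕ→ℚ-homo-* m q ⟨
    ℕ→ℚ (m ℕ.* q)       ≤⟨ ℕ→ℚ-mono-≤ mq≤pn ⟩
    ℕ→ℚ (p ℕ.* n)       ≡⟨ ℕ→ℚ-homo-* p n ⟩
    ℕ→ℚ p * ℕ→ℚ n       ≡⟨ cong (_* ℕ→ℚ n) x*q≡p ⟨
    x * ℕ→ℚ q * ℕ→ℚ n   ≡⟨ xy∙z≈xz∙y x (ℕ→ℚ q) (ℕ→ℚ n) ⟩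
    x * ℕ→ℚ n * ℕ→ℚ q   ∎)
    where open ℚ.≤-Reasoning

  ≤-cross⁻ : ∀ {m n} → ℕ→ℚ m ≤ x * ℕ→ℚ n → m ℕ.* q ℕ.≤ p ℕ.* n
  ≤-cross⁻ {m} {n} m≤xn = ℕ→ℚ-cancel-≤ (begin
    ℕ→ℚ (m ℕ.* q)       ≡⟨ ℕ→ℚ-homo-* m q ⟩
    ℕ→ℚ m * ℕ→ℚ q       ≤⟨ ℚ.*-monoʳ-≤-nonNeg (ℕ→ℚ q) {{ℚ.pos⇒nonNeg (ℕ→ℚ q) {{ℕ→ℚ-pos q}}}} m≤xn ⟩
    x * ℕ→ℚ n * ℕ→ℚ q   ≡⟨ xy∙z≈xz∙y x (ℕ→ℚ n) (ℕ→ℚ q) ⟩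
    x * ℕ→ℚ q * ℕ→ℚ n   ≡⟨ cong (_* ℕ→ℚ n) x*q≡p ⟩
    ℕ→ℚ p * ℕ→ℚ n       ≡⟨ ℕ→ℚ-homo-* p n ⟨
    ℕ→ℚ (p ℕ.* n)       ∎)
    where open ℚ.≤-Reasoning

  <1⇒num<den : x < 1ℚ → p ℕ.< q
  <1⇒num<den x<1 =
    ℕ→ℚ-cancel-< (subst₂ _<_ x*q≡p (ℚ.*-identityˡ _) (ℚ.*-monoˡ-<-pos (ℕ→ℚ q) {{ℕ→ℚ-pos q}} x<1))

  cube-fraction : x * x * x * ℕ→ℚ (q ℕ.* q ℕ.* q) ≡ ℕ→ℚ (p ℕ.* p ℕ.* p)
  cube-fraction = begin
    x * x * x * ℕ→ℚ (q ℕ.* q ℕ.* q)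
      ≡⟨ cong (x * x * x *_) (trans (ℕ→ℚ-homo-* (q ℕ.* q) q) (cong (_* ℕ→ℚ q) (ℕ→ℚ-homo-* q q))) ⟩
    x * x * x * (ℕ→ℚ q * ℕ→ℚ q * ℕ→ℚ q)
      ≡⟨ solve 2 (λ x y → x :* x :* x :* (y :* y :* y) := (x :* y) :* (x :* y) :* (x :* y)) refl x (ℕ→ℚ q) ⟩
    (x * ℕ→ℚ q) * (x * ℕ→ℚ q) * (x * ℕ→ℚ q)
      ≡⟨ cong (λ y → y * y * y) x*q≡p ⟩
    ℕ→ℚ p * ℕ→ℚ p * ℕ→ℚ p
      ≡⟨ trans (ℕ→ℚ-homo-* (p ℕ.* p) p) (cong (_* ℕ→ℚ p) (ℕ→ℚ-homo-* p p)) ⟨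
    ℕ→ℚ (p ℕ.* p ℕ.* p) ∎
    where
    open ≡-Reasoning
    open +-*-Solver

below-min⇒lossy : ∀ {u w s k : ℕ} {e : ℚ} → ℕ→ℚ k ≤ e * ℕ→ℚ s →
  ¬ ((ℕ→ℚ u ℚ.- e * ℕ→ℚ s) ℚ.⊓ ℕ→ℚ s ≤ ℕ→ℚ w) → w ℕ.< s × w ℕ.+ k ℕ.< u
below-min⇒lossy {u} {w} {s} {k} {e} k≤es ¬min≤w =
  ℕ→ℚ-cancel-< (ℚ.<-≤-trans w<min (ℚ.p⊓q≤q u-es (ℕ→ℚ s))) ,
  ℕ→ℚ-cancel-< (begin-strict
    ℕ→ℚ (w ℕ.+ k)             ≡⟨ ℕ→ℚ-homo-+ w k ⟩
    ℕ→ℚ w ℚ.+ ℕ→ℚ k           ≤⟨ ℚ.+-monoʳ-≤ (ℕ→ℚ w) k≤es ⟩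
    ℕ→ℚ w ℚ.+ e * ℕ→ℚ s       <⟨ ℚ.+-monoˡ-< (e * ℕ→ℚ s) (ℚ.<-≤-trans w<min (ℚ.p⊓q≤p u-es (ℕ→ℚ s))) ⟩
    u-es ℚ.+ e * ℕ→ℚ s        ≡⟨ solve 2 (λ a b → a :- b :+ b := a) refl (ℕ→ℚ u) (e * ℕ→ℚ s) ⟩
    ℕ→ℚ u                     ∎)
  where
  open ℚ.≤-Reasoning
  open +-*-Solver
  u-es = ℕ→ℚ u ℚ.- e * ℕ→ℚ s
  w<min = ℚ.≰⇒> ¬min≤w

not-goodFor⇒lossy : ∀ {s n n'} (ε : ℚ) (S : Fin s → Subset n) (φ : Fin n → Fin n') k I →
  ℕ→ℚ k ≤ ε * ℕ→ℚ s → ¬ T (goodFor ε S φ I) → Lossy S φ k I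
not-goodFor⇒lossy {s} ε S φ k I k≤εs ¬goodFor =
  below-min⇒lossy {∣ U ∣} {∣ W ∣} {s} {k} {ε} k≤εs (¬goodFor ∘ fromWitness {a? = min ℚ.≤? ℕ→ℚ ∣ W ∣})
  where
  U = bigUnion I S
  W = bigUnion I (image φ ∘ S)
  min = (ℕ→ℚ ∣ U ∣ ℚ.- ε * ℕ→ℚ s) ℚ.⊓ ℕ→ℚ s

not-good⇒¬goodFor : ∀ {s n n'} (ε : ℚ) (S : Fin s → Subset n) (φ : Fin n → Fin n') →
  T (not (good ε S φ)) → ∃[ I ] ¬ T (goodFor ε S φ I)
not-good⇒¬goodFor {s} ε S φ not-good = satisfied (¬All⇒Any¬ (T? ∘ goodFor ε S φ) (allSubsets s) ¬all)
  where
  ¬all : ¬ All (T ∘ goodFor ε S φ) (allSubsets s)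
  ¬all = subst T (Equivalence.to T-not-≡ not-good) ∘ all⁻ (goodFor ε S φ)

lemma3p7 : Σ ℚ λ C₀ → (C₁ : ℚ) → (ε : ℚ) → 0ℚ < ε → ε < 1ℚ → (δ : ℚ) → 0ℚ < δ →
  Σ ℕ λ s₀ → (s : ℕ) → s ≥ s₀ → (n : ℕ) → (S : Fin s → Subset n) → (n' : ℕ) →
    C₀ * ℕ→ℚ s ≤ ℕ→ℚ n' * (ε * ε * ε) → ℕ→ℚ n' * (ε * ε * ε) ≤ C₁ * ℕ→ℚ s →
    ℕ→ℚ (badCount n n' ε S) ≤ δ * ℕ→ℚ (n' ^ n)
lemma3p7 = ℕ→ℚ 8192 , λ _ ε 0<ε ε<1 δ 0<δ →
  let (p , q , εq≡p) = positive⇒fraction 0<ε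
      (a , b , δb≡a) = positive⇒fraction 0<δ
      P = ℕ.suc p ; Q = ℕ.suc q ; A = ℕ.suc a ; B = ℕ.suc b
  in B ℕ.* Q , λ s B*Q≤s n S n' C₀s≤n'ε³ _ →
    let open Parameters P Q s using (k; k*q≤p*s)
        k≤εs = ≤-cross⁺ ε P Q εq≡p {k} {s} k*q≤p*s
        C₀sQ³≤P³n' = ≤-cross⁻ (ε * ε * ε) (P ℕ.* P ℕ.* P) (Q ℕ.* Q ℕ.* Q) (cube-fraction ε P Q εq≡p) {8192 ℕ.* s} {n'}
                       (subst₂ _≤_ (sym (ℕ→ℚ-homo-* 8192 s)) (ℚ.*-comm (ℕ→ℚ n') (ε * ε * ε)) C₀s≤n'ε³)
        bad⇒lossy = λ {φ} → map₂ (λ {I} → not-goodFor⇒lossy ε S φ k I k≤εs) ∘ not-good⇒¬goodFor ε S φ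
        B*bad≤n'ⁿ = lossy-maps-rare S (not ∘ good ε S) P Q B (ℕ.<⇒≤ (<1⇒num<den ε P Q εq≡p ε<1))
                      B*Q≤s C₀sQ³≤P³n' bad⇒lossy
    in ≤-cross⁺ δ A B δb≡a {badCount n n' ε S} {n' ^ n}
         (ℕ.≤-trans (ℕ.≤-reflexive (ℕ.*-comm _ B)) (ℕ.≤-trans B*bad≤n'ⁿ (ℕ.m≤n*m _ A)))
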